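{- For every hypergraph $\mathcal{H}=(V,E)$, the following are equivalent: (1) $\mathcal{H}$ is $1$-Sperner; (2) the bigraph of $\mathcal{H}$ is right-Sperner and $2P_3$-free in the labeled sense; (3) the vertex-clique split graph of $\mathcal{H}$ is independent-Sperner and $\overline{H}$-free (in the labeled sense); (4) the edge-clique split graph of $\mathcal{H}$ is clique-Sperner and $H$-free (in the labeled sense).
   Context: A hypergraph $\mathcal{H}=(V,E)$ consists of a finite vertex set $V$ and a set $E$ of subsets of $V$ (hyperedges). $\mathcal{H}$ is $1$-Sperner if every two distinct hyperedges $e,f$ satisfy $\min\{|e\setminus f|,|f\setminus e|\}=1$. A labeled bigraph is a triple $(G,A,B)$ where $G$ is a graph and $(A,B)$ a partition of $V(G)$ into two independent sets; a labeled split graph is a triple $(G,K,I)$ where $(K,I)$ partitions $V(G)$ into a clique $K$ and an independent set $I$. The bigraph of $\mathcal{H}$ is the labeled bigraph $(G,V,E)$ with vertex set $V\cup E$ where $v\in V$ is adjacent to $e\in E$ iff $v\in e$. The vertex-clique split graph of $\mathcal{H}$ is the labeled split graph $(G,V,E)$ in which $V$ is a clique, $E$ is independent, and $v\in V$ is adjacent to $e\in E$ iff $v\in e$. The edge-clique split graph of $\mathcal{H}$ is the labeled split graph $(G,E,V)$ in which $E$ is a clique, $V$ is independent, and $v\in V$ is adjacent to $e\in E$ iff $v\in e$. A labeled bigraph $(G,A,B)$ is right-Sperner if for all $u,v\in B$, $N(u)\subseteq N(v)$ implies $u=v$. A labeled split graph $(G,K,I)$ is clique-Sperner if for all $u,v\in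 K$, $N(u)\cap I\subseteq N(v)\cap I$ implies $u=v$, and independent-Sperner if for all $u,v\in I$, $N(u)\subseteq N(v)$ implies $u=v$. A labeled split graph $(G_1,K^1,I^1)$ is an induced subgraph of $(G_2,K^2,I^2)$ if there are injections $f:K^1\to K^2$, $g:I^1\to I^2$ such that for all $u\in K^1$, $v\in I^1$, $u$ and $v$ are adjacent in $G_1$ iff $f(u)$ and $g(v)$ are adjacent in $G_2$; otherwise $(G_2,K^2,I^2)$ is $(G_1,K^1,I^1)$-free (labeled sense); analogously for labeled bigraphs with injections $A^1\to A^2$, $B^1\to B^2$. The labeled bigraph $2P_3$ has $A=\{x_1,y_1,x_2,y_2\}$, $B=\{c_1,c_2\}$ and edges $c_1x_1,c_1y_1,c_2x_2,c_2y_2$. The labeled split graph $H$ has $K=\{c_1,c_2\}$, $I=\{x_1,y_1,x_2,y_2\}$ and edges $c_1c_2,c_1x_1,c_1y_1,c_2x_2,c_2y_2$. The labeled split graph $\overline{H}$ (the complement of $H$) has $K=\{x_1,y_1,x_2,y_2\}$ a clique, $I=\{c_1,c_2\}$, with $c_1$ adjacent to $x_2,y_2$ and $c_2$ adjacent to $x_1,y_1$ (and no other $K$–$I$ edges). -}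

module Defs where

open import Data.Nat using (ℕ; _⊓_)
open import Data.Fin using (Fin; zero; suc)
open import Data.Fin.Subset using (Subset; _∈_; _─_; ∣_∣)
open import Data.Empty using (⊥)
open import Data.Unit using (⊤)
open import Relation.Binary.PropositionalEquality using (_≡_)
open import Relation.Nullary using (¬_)
open import Function.Definitions using (Injective)

-- Hypergraphs: vertex set V = Fin n, hyperedge set E indexed by Fin m,
-- given by an injective map into subsets of V (so E is a *set* of subsets).

record Hypergraph : Set where
  field
    n m      : ℕ
    edge     : Fin m → Subset n
    edge-inj : Injective _≡_ _≡_ edge
open Hypergraph public

OneSperner : Hypergraph → Set
OneSperner ℋ = ∀ (i j : Fin (m ℋ)) → ¬ (i ≡ j) →
  (∣ edge ℋ i ─ edge ℋ j ∣ ⊓ ∣ edge ℋ j ─ edge ℋ i ∣) ≡ 1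

-- Labeled bigraphs (G, A, B): A = Fin nA and B = Fin nB are independent,
-- so G is determined by the A–B adjacency relation.

record LBigraph : Set₁ where
  field
    nA nB : ℕ
    adj   : Fin nA → Fin nB → Set
open LBigraph public

RightSperner : LBigraph → Set
RightSperner G = ∀ (u v : Fin (nB G)) →
  (∀ (x : Fin (nA G)) → adj G x u → adj G x v) → u ≡ v

record BigraphInduced (G₁ G₂ : LBigraph) : Set where
  field
    f     : Fin (nA G₁) → Fin (nA G₂)
    g     : Fin (nB G₁) → Fin (nB G₂)
    f-inj : Injective _≡_ _≡_ f
    g-inj : Injective _≡_ _≡_ g
    pres  : ∀ a b → adj G₁ a b → adj G₂ (f a) (g b)
    refl′ : ∀ a b → adj G₂ (f a) (g b) → adj G₁ a b

BigraphFree : LBigraph → LBigraph → Set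
BigraphFree G₁ G₂ = ¬ BigraphInduced G₁ G₂   -- G₂ is G₁-free

-- Labeled split graphs (G, K, I): K = Fin nK is a clique, I = Fin nI is
-- independent, so G is determined by the K–I adjacency relation.

record LSplit : Set₁ where
  field
    nK nI : ℕ
    sadj  : Fin nK → Fin nI → Set
open LSplit public

CliqueSperner : LSplit → Set
CliqueSperner G = ∀ (u v : Fin (nK G)) →
  (∀ (x : Fin (nI G)) → sadj G u x → sadj G v x) → u ≡ v

IndependentSperner : LSplit → Set
IndependentSperner G = ∀ (u v : Fin (nI G)) →
  (∀ (x : Fin (nK G)) → sadj G x u → sadj G x v) → u ≡ v

record SplitInduced (G₁ G₂ : LSplit) : Set where
  field
    f     : Fin (nK G₁) → Fin (nK G₂)
    g     : Fin (nI G₁) → Fin (nI G₂)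
    f-inj : Injective _≡_ _≡_ f
    g-inj : Injective _≡_ _≡_ g
    pres  : ∀ a b → sadj G₁ a b → sadj G₂ (f a) (g b)
    refl′ : ∀ a b → sadj G₂ (f a) (g b) → sadj G₁ a b

SplitFree : LSplit → LSplit → Set
SplitFree G₁ G₂ = ¬ SplitInduced G₁ G₂

bigraphOf : Hypergraph → LBigraph
bigraphOf ℋ = record { nA = n ℋ ; nB = m ℋ ; adj = λ v e → v ∈ edge ℋ e }

vertexCliqueSplit : Hypergraph → LSplit
vertexCliqueSplit ℋ = record { nK = n ℋ ; nI = m ℋ ; sadj = λ v e → v ∈ edge ℋ e }

edgeCliqueSplit : Hypergraph → LSplit
edgeCliqueSplit ℋ = record { nK = m ℋ ; nI = n ℋ ; sadj = λ e v → v ∈ edge ℋ e }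

-- Small graphs.  Indexing: x₁ = 0, y₁ = 1, x₂ = 2, y₂ = 3 in Fin 4;
-- c₁ = 0, c₂ = 1 in Fin 2.

twoStars : Fin 2 → Fin 4 → Set
twoStars zero       zero                   = ⊤
twoStars zero       (suc zero)             = ⊤
twoStars zero       (suc (suc _))          = ⊥
twoStars (suc zero) zero                   = ⊥
twoStars (suc zero) (suc zero)             = ⊥
twoStars (suc zero) (suc (suc _))          = ⊤

2P₃ : LBigraph
2P₃ = record { nA = 4 ; nB = 2 ; adj = λ x c → twoStars c x }

Hs : LSplit
Hs = record { nK = 2 ; nI = 4 ; sadj = twoStars }

-- complement of H: K = {x₁,y₁,x₂,y₂}, I = {c₁,c₂}, c₁ ~ x₂,y₂ and c₂ ~ x₁,y₁
crossStars : Fin 4 → Fin 2 → Set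
crossStars x zero       = twoStars (suc zero) x
crossStars x (suc zero) = twoStars zero x

H̄s : LSplit
H̄s = record { nK = 4 ; nI = 2 ; sadj = crossStars }

-- The three Sperner conditions all say literally "no hyperedge is contained
-- in another".  Everything else rests on one notion: two B-vertices u ≠ v of
-- a bigraph CROSS if each has two distinct private neighbours (neighbours
-- not adjacent to the other one).
module Submission where

open import Defs
open import Data.Product using (_×_)
open import Function.Bundles using (_⇔_)

open import Data.Empty using (⊥-elim)
open import Data.Fin using (Fin; zero; suc; _≟_)
open import Data.Fin.Properties using (suc-injective)
open import Data.Fin.Subset
  using (Subset; inside; outside; _∈_; _∉_; _─_; ∣_∣; _⊆_; _⊈_; Nonempty; Empty)
open import Data.Fin.Subset.Properties
  using (_∈?_; nonempty?; Empty-unique; ∣⊥∣≡0; x∈p∧x∉q⇒x∈p─q; p─q⊆p;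
         x∈p∧x≢y⇒x∈p-y; x∈p⇒∣p-x∣<∣p∣)
open import Data.Nat using (zero; suc; _⊓_; _≤_; s≤s; z≤n)
open import Data.Nat.Properties using (≤-trans; n≢0⇒n>0)
open import Data.Product using (Σ-syntax; _,_; proj₁; proj₂)
open import Data.Product.Function.NonDependent.Propositional using (_×-⇔_)
open import Data.Unit using (tt)
open import Data.Vec using (_∷_)
open import Data.Vec.Base using (here; there)
open import Function.Bundles using (mk⇔; Equivalence)
import Function.Properties.Equivalence as ⇔
open import Function.Related.TypeIsomorphisms using (¬-cong-⇔)
open import Relation.Binary.PropositionalEquality using (_≡_; _≢_; refl; sym; subst)
open import Relation.Nullary using (¬_; yes; no; contradiction)
open import Relation.Nullary.Decidable using (decidable-stable)

x∈p─q⇒x∉q : ∀ {k} {x : Fin k} (p q : Subset k) → x ∈ p ─ q → x ∉ q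
x∈p─q⇒x∉q (inside ∷ p)  (outside ∷ q) here ()
x∈p─q⇒x∉q (_ ∷ p)       (_ ∷ q)       (there x∈p─q) (there x∈q) = x∈p─q⇒x∉q p q x∈p─q x∈q

∈⇒1≤∣∣ : ∀ {k} {x : Fin k} {s : Subset k} → x ∈ s → 1 ≤ ∣ s ∣
∈⇒1≤∣∣ x∈s = ≤-trans (s≤s z≤n) (x∈p⇒∣p-x∣<∣p∣ x∈s)

Empty⇒∣∣≡0 : ∀ {k} {s : Subset k} → Empty s → ∣ s ∣ ≡ 0
Empty⇒∣∣≡0 {k} empty rewrite Empty-unique empty = ∣⊥∣≡0 k

1≤∣∣⇒Nonempty : ∀ {k} (s : Subset k) → 1 ≤ ∣ s ∣ → Nonempty s
1≤∣∣⇒Nonempty s 1≤∣s∣ with nonempty? s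
... | yes nonempty = nonempty
... | no  empty    = contradiction (subst (1 ≤_) (Empty⇒∣∣≡0 empty) 1≤∣s∣) λ ()

distinct⇒2≤∣∣ : ∀ {k} {x y : Fin k} {s : Subset k} → x ≢ y → x ∈ s → y ∈ s → 2 ≤ ∣ s ∣
distinct⇒2≤∣∣ x≢y x∈s y∈s =
  ≤-trans (s≤s (∈⇒1≤∣∣ (x∈p∧x≢y⇒x∈p-y y∈s (λ y≡x → x≢y (sym y≡x))))) (x∈p⇒∣p-x∣<∣p∣ x∈s)

2≤∣∣⇒distinct : ∀ {k} (s : Subset k) → 2 ≤ ∣ s ∣ →
  Σ[ x ∈ Fin k ] Σ[ y ∈ Fin k ] x ≢ y × x ∈ s × y ∈ s
2≤∣∣⇒distinct (inside ∷ s) (s≤s 1≤∣s∣) with 1≤∣∣⇒Nonempty s 1≤∣s∣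
... | y , y∈s = zero , suc y , (λ ()) , here , there y∈s
2≤∣∣⇒distinct (outside ∷ s) 2≤∣s∣ with 2≤∣∣⇒distinct s 2≤∣s∣
... | x , y , x≢y , x∈s , y∈s =
  suc x , suc y , (λ sx≡sy → x≢y (suc-injective sx≡sy)) , there x∈s , there y∈s

⊓≡1⇔ : ∀ a b → a ⊓ b ≡ 1 ⇔ (1 ≤ a × 1 ≤ b × ¬ (2 ≤ a × 2 ≤ b))
⊓≡1⇔ a b = mk⇔ (to a b) (from a b)
  where
  to : ∀ a b → a ⊓ b ≡ 1 → 1 ≤ a × 1 ≤ b × ¬ (2 ≤ a × 2 ≤ b)
  to (suc zero)    (suc b)       _  = s≤s z≤n , s≤s z≤n , λ { (s≤s () , _) }
  to (suc (suc a)) (suc zero)    _  = s≤s z≤n , s≤s z≤n , λ { (_ , s≤s ()) }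
  to (suc (suc a)) (suc (suc b)) ()
  from : ∀ a b → 1 ≤ a × 1 ≤ b × ¬ (2 ≤ a × 2 ≤ b) → a ⊓ b ≡ 1
  from (suc zero)    (suc b)       _ = refl
  from (suc (suc a)) (suc zero)    _ = refl
  from (suc (suc a)) (suc (suc b)) (_ , _ , ¬both) =
    contradiction (s≤s (s≤s z≤n) , s≤s (s≤s z≤n)) ¬both

TwoPrivate : {A : Set} → (A → Set) → (A → Set) → Set
TwoPrivate {A} P Q = Σ[ x ∈ A ] Σ[ y ∈ A ] x ≢ y × (P x × ¬ Q x) × (P y × ¬ Q y)

1≤∣─∣⇔⊈ : ∀ {k} (p q : Subset k) → 1 ≤ ∣ p ─ q ∣ ⇔ p ⊈ q
1≤∣─∣⇔⊈ p q = mk⇔ to from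
  where
  to : 1 ≤ ∣ p ─ q ∣ → p ⊈ q
  to 1≤∣p─q∣ p⊆q with 1≤∣∣⇒Nonempty (p ─ q) 1≤∣p─q∣
  ... | x , x∈p─q = x∈p─q⇒x∉q p q x∈p─q (p⊆q (p─q⊆p p q x∈p─q))
  ∣─∣≡0⇒⊆ : ∣ p ─ q ∣ ≡ 0 → p ⊆ q
  ∣─∣≡0⇒⊆ ∣p─q∣≡0 {x} x∈p = decidable-stable (x ∈? q) λ x∉q →
    contradiction (subst (1 ≤_) ∣p─q∣≡0 (∈⇒1≤∣∣ (x∈p∧x∉q⇒x∈p─q x∈p x∉q))) λ ()
  from : p ⊈ q → 1 ≤ ∣ p ─ q ∣
  from p⊈q = n≢0⇒n>0 λ ∣p─q∣≡0 → p⊈q (∣─∣≡0⇒⊆ ∣p─q∣≡0)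

2≤∣─∣⇔TwoPrivate : ∀ {k} (p q : Subset k) → 2 ≤ ∣ p ─ q ∣ ⇔ TwoPrivate (_∈ p) (_∈ q)
2≤∣─∣⇔TwoPrivate p q = mk⇔ to from
  where
  to : 2 ≤ ∣ p ─ q ∣ → TwoPrivate (_∈ p) (_∈ q)
  to 2≤∣p─q∣ with 2≤∣∣⇒distinct (p ─ q) 2≤∣p─q∣
  ... | x , y , x≢y , x∈p─q , y∈p─q =
    x , y , x≢y , (p─q⊆p p q x∈p─q , x∈p─q⇒x∉q p q x∈p─q)
                , (p─q⊆p p q y∈p─q , x∈p─q⇒x∉q p q y∈p─q)
  from : TwoPrivate (_∈ p) (_∈ q) → 2 ≤ ∣ p ─ q ∣
  from (x , y , x≢y , (x∈p , x∉q) , (y∈p , y∉q)) =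
    distinct⇒2≤∣∣ x≢y (x∈p∧x∉q⇒x∈p─q x∈p x∉q) (x∈p∧x∉q⇒x∈p─q y∈p y∉q)

⊓∣─∣≡1⇔ : ∀ {k} (p q : Subset k) →
  ∣ p ─ q ∣ ⊓ ∣ q ─ p ∣ ≡ 1 ⇔
  (p ⊈ q × q ⊈ p × ¬ (TwoPrivate (_∈ p) (_∈ q) × TwoPrivate (_∈ q) (_∈ p)))
⊓∣─∣≡1⇔ p q = ⇔.trans (⊓≡1⇔ ∣ p ─ q ∣ ∣ q ─ p ∣)
  (1≤∣─∣⇔⊈ p q ×-⇔ 1≤∣─∣⇔⊈ q p ×-⇔ ¬-cong-⇔ (2≤∣─∣⇔TwoPrivate p q ×-⇔ 2≤∣─∣⇔TwoPrivate q p))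

N : (G : LBigraph) → Fin (nB G) → Fin (nA G) → Set
N G u a = adj G a u

Crossing : (G : LBigraph) → Fin (nB G) → Fin (nB G) → Set
Crossing G u v = TwoPrivate (N G u) (N G v) × TwoPrivate (N G v) (N G u)

CrossingFree : LBigraph → Set
CrossingFree G = ∀ u v → u ≢ v → ¬ Crossing G u v

pattern 0F = zero
pattern 1F = suc zero
pattern 2F = suc (suc zero)
pattern 3F = suc (suc (suc zero))

2P₃⇒crossing : ∀ {G} → BigraphInduced 2P₃ G → Σ[ u ∈ _ ] Σ[ v ∈ _ ] u ≢ v × Crossing G u v
2P₃⇒crossing r =
  g 0F , g 1F , (λ e → contradiction (g-inj e) λ ())
  , (f 0F , f 1F , (λ e → contradiction (f-inj e) λ ()) , (pres 0F 0F tt , refl′ 0F 1F)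
                                                        , (pres 1F 0F tt , refl′ 1F 1F))
  , (f 2F , f 3F , (λ e → contradiction (f-inj e) λ ()) , (pres 2F 1F tt , refl′ 2F 0F)
                                                        , (pres 3F 1F tt , refl′ 3F 0F))
  where open BigraphInduced r

-- Conversely a crossing pair u, v with private neighbours x₁, y₁ of u and
-- x₂, y₂ of v spans an induced 2P₃; the leaves of different centres are
-- distinct because exactly one of them is adjacent to u.
crossing⇒2P₃ : ∀ {G} u v → u ≢ v → Crossing G u v → BigraphInduced 2P₃ G
crossing⇒2P₃ {G} u v u≢v
  ((x₁ , y₁ , x₁≢y₁ , (x₁u , x₁v) , (y₁u , y₁v)) , (x₂ , y₂ , x₂≢y₂ , (x₂v , x₂u) , (y₂v , y₂u))) =
  record { f = leaf ; g = centre ; f-inj = leaf-inj ; g-inj = centre-inj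
         ; pres = preserves ; refl′ = reflects }
  where
  leaf : Fin 4 → Fin (nA G)
  leaf 0F = x₁
  leaf 1F = y₁
  leaf 2F = x₂
  leaf 3F = y₂
  centre : Fin 2 → Fin (nB G)
  centre 0F = u
  centre 1F = v
  separated : ∀ {a b w} → adj G a w → ¬ adj G b w → a ≢ b
  separated aw ¬bw refl = ¬bw aw
  leaf-inj : ∀ {i j} → leaf i ≡ leaf j → i ≡ j
  leaf-inj {0F} {0F} _ = refl
  leaf-inj {0F} {1F} e = contradiction e x₁≢y₁
  leaf-inj {0F} {2F} e = contradiction e (separated x₁u x₂u)
  leaf-inj {0F} {3F} e = contradiction e (separated x₁u y₂u)
  leaf-inj {1F} {0F} e = contradiction (sym e) x₁≢y₁
  leaf-inj {1F} {1F} _ = refl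
  leaf-inj {1F} {2F} e = contradiction e (separated y₁u x₂u)
  leaf-inj {1F} {3F} e = contradiction e (separated y₁u y₂u)
  leaf-inj {2F} {0F} e = contradiction e (separated x₂v x₁v)
  leaf-inj {2F} {1F} e = contradiction e (separated x₂v y₁v)
  leaf-inj {2F} {2F} _ = refl
  leaf-inj {2F} {3F} e = contradiction e x₂≢y₂
  leaf-inj {3F} {0F} e = contradiction e (separated y₂v x₁v)
  leaf-inj {3F} {1F} e = contradiction e (separated y₂v y₁v)
  leaf-inj {3F} {2F} e = contradiction (sym e) x₂≢y₂
  leaf-inj {3F} {3F} _ = refl
  centre-inj : ∀ {i j} → centre i ≡ centre j → i ≡ j
  centre-inj {0F} {0F} _ = refl
  centre-inj {0F} {1F} e = contradiction e u≢v
  centre-inj {1F} {0F} e = contradiction (sym e) u≢v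
  centre-inj {1F} {1F} _ = refl
  preserves : ∀ a c → twoStars c a → adj G (leaf a) (centre c)
  preserves 0F 0F _ = x₁u
  preserves 1F 0F _ = y₁u
  preserves 2F 1F _ = x₂v
  preserves 3F 1F _ = y₂v
  preserves 0F 1F ()
  preserves 1F 1F ()
  preserves 2F 0F ()
  preserves 3F 0F ()
  reflects : ∀ a c → adj G (leaf a) (centre c) → twoStars c a
  reflects 0F 0F _ = tt
  reflects 1F 0F _ = tt
  reflects 2F 1F _ = tt
  reflects 3F 1F _ = tt
  reflects 0F 1F x₁v′ = x₁v x₁v′
  reflects 1F 1F y₁v′ = y₁v y₁v′
  reflects 2F 0F x₂u′ = x₂u x₂u′
  reflects 3F 0F y₂u′ = y₂u y₂u′

2P₃-free⇔CrossingFree : ∀ G → BigraphFree 2P₃ G ⇔ CrossingFree G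
2P₃-free⇔CrossingFree G = mk⇔
  (λ free u v u≢v crossing → free (crossing⇒2P₃ u v u≢v crossing))
  (λ crossingFree r → let (u , v , u≢v , crossing) = 2P₃⇒crossing r
                      in crossingFree u v u≢v crossing)

-- 1-Sperner = Sperner + no crossing pair of hyperedges: apply the pairwise
-- condition ⊓∣─∣≡1⇔ to every pair of distinct hyperedges; an inclusion
-- between distinct hyperedges is exactly a violation of right-Sperner.
oneSperner⇔ : ∀ ℋ → OneSperner ℋ ⇔ (RightSperner (bigraphOf ℋ) × CrossingFree (bigraphOf ℋ))
oneSperner⇔ ℋ = mk⇔ to from
  where
  pair : ∀ i j → ∣ edge ℋ i ─ edge ℋ j ∣ ⊓ ∣ edge ℋ j ─ edge ℋ i ∣ ≡ 1 ⇔
    (edge ℋ i ⊈ edge ℋ j × edge ℋ j ⊈ edge ℋ i × ¬ Crossing (bigraphOf ℋ) i j)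
  pair i j = ⊓∣─∣≡1⇔ (edge ℋ i) (edge ℋ j)
  to : OneSperner ℋ → RightSperner (bigraphOf ℋ) × CrossingFree (bigraphOf ℋ)
  to oneSperner = sperner , λ i j i≢j → proj₂ (proj₂ (Equivalence.to (pair i j) (oneSperner i j i≢j)))
    where
    sperner : RightSperner (bigraphOf ℋ)
    sperner i j i⊆j with i ≟ j
    ... | yes i≡j = i≡j
    ... | no  i≢j = ⊥-elim (proj₁ (Equivalence.to (pair i j) (oneSperner i j i≢j)) (i⊆j _))
  from : RightSperner (bigraphOf ℋ) × CrossingFree (bigraphOf ℋ) → OneSperner ℋ
  from (sperner , crossingFree) i j i≢j = Equivalence.from (pair i j)
    ( (λ i⊆j → i≢j (sperner i j λ _ → i⊆j))
    , (λ j⊆i → i≢j (sym (sperner j i λ _ → j⊆i)))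
    , crossingFree i j i≢j )

asBigraph : LSplit → LBigraph
asBigraph G = record { nA = nK G ; nB = nI G ; adj = sadj G }

_ᵀ : LBigraph → LBigraph
G ᵀ = record { nA = nB G ; nB = nA G ; adj = λ b a → adj G a b }

-- a labeled split graph and its underlying bigraph have the same induced
-- labeled subgraphs (the clique edges carry no information)
splitFree⇔ : ∀ {G₁ G₂} → SplitFree G₁ G₂ ⇔ BigraphFree (asBigraph G₁) (asBigraph G₂)
splitFree⇔ = mk⇔ (λ free r → free (fromBigraph r)) (λ free r → free (toBigraph r))
  where
  toBigraph : ∀ {G₁ G₂} → SplitInduced G₁ G₂ → BigraphInduced (asBigraph G₁) (asBigraph G₂)
  toBigraph r = record { f = f ; g = g ; f-inj = f-inj ; g-inj = g-inj ; pres = pres ; refl′ = refl′ }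
    where open SplitInduced r
  fromBigraph : ∀ {G₁ G₂} → BigraphInduced (asBigraph G₁) (asBigraph G₂) → SplitInduced G₁ G₂
  fromBigraph r = record { f = f ; g = g ; f-inj = f-inj ; g-inj = g-inj ; pres = pres ; refl′ = refl′ }
    where open BigraphInduced r

transpose : ∀ {G₁ G₂} → BigraphInduced G₁ G₂ → BigraphInduced (G₁ ᵀ) (G₂ ᵀ)
transpose r = record { f = g ; g = f ; f-inj = g-inj ; g-inj = f-inj
                     ; pres = λ b a → pres a b ; refl′ = λ b a → refl′ a b }
  where open BigraphInduced r

-- transposing twice is the identity (by record η), so freeness is invariant
free-transpose⇔ : ∀ G₁ G₂ → BigraphFree G₁ G₂ ⇔ BigraphFree (G₁ ᵀ) (G₂ ᵀ)
free-transpose⇔ _ _ = mk⇔ (λ free r → free (transpose r)) (λ free r → free (transpose r))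

_⨾_ : ∀ {G₁ G₂ G₃} → BigraphInduced G₁ G₂ → BigraphInduced G₂ G₃ → BigraphInduced G₁ G₃
r ⨾ s = record
  { f = λ a → S.f (R.f a) ; g = λ b → S.g (R.g b)
  ; f-inj = λ e → R.f-inj (S.f-inj e) ; g-inj = λ e → R.g-inj (S.g-inj e)
  ; pres = λ a b e → S.pres _ _ (R.pres a b e) ; refl′ = λ a b e → R.refl′ a b (S.refl′ _ _ e) }
  where
  module R = BigraphInduced r
  module S = BigraphInduced s

free-pattern⇔ : ∀ {X Y G} → BigraphInduced X Y → BigraphInduced Y X →
  BigraphFree X G ⇔ BigraphFree Y G
free-pattern⇔ X↪Y Y↪X = mk⇔ (λ free r → free (X↪Y ⨾ r)) (λ free r → free (Y↪X ⨾ r))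

-- H̄, read as a bigraph, is 2P₃ with its centres c₁, c₂ exchanged

swap : Fin 2 → Fin 2
swap 0F = 1F
swap 1F = 0F

swap-inj : ∀ {i j} → swap i ≡ swap j → i ≡ j
swap-inj {0F} {0F} _ = refl
swap-inj {1F} {1F} _ = refl
swap-inj {0F} {1F} ()
swap-inj {1F} {0F} ()

2P₃↪H̄ : BigraphInduced 2P₃ (asBigraph H̄s)
2P₃↪H̄ = record { f = λ a → a ; g = swap ; f-inj = λ e → e ; g-inj = swap-inj
               ; pres = swapped ; refl′ = unswapped }
  where
  swapped : ∀ a c → twoStars c a → crossStars a (swap c)
  swapped a 0F t = t
  swapped a 1F t = t
  unswapped : ∀ a c → crossStars a (swap c) → twoStars c a
  unswapped a 0F t = t
  unswapped a 1F t = t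

H̄↪2P₃ : BigraphInduced (asBigraph H̄s) 2P₃
H̄↪2P₃ = record { f = λ a → a ; g = swap ; f-inj = λ e → e ; g-inj = swap-inj
               ; pres = swapped ; refl′ = unswapped }
  where
  swapped : ∀ a c → crossStars a c → twoStars (swap c) a
  swapped a 0F t = t
  swapped a 1F t = t
  unswapped : ∀ a c → twoStars (swap c) a → crossStars a c
  unswapped a 0F t = t
  unswapped a 1F t = t

corollary4p6 : (ℋ : Hypergraph) →
    (OneSperner ℋ ⇔ (RightSperner (bigraphOf ℋ) × BigraphFree 2P₃ (bigraphOf ℋ)))
    × (OneSperner ℋ ⇔ (IndependentSperner (vertexCliqueSplit ℋ) × SplitFree H̄s (vertexCliqueSplit ℋ)))
    × (OneSperner ℋ ⇔ (CliqueSperner (edgeCliqueSplit ℋ) × SplitFree Hs (edgeCliqueSplit ℋ)))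
corollary4p6 ℋ = bigraphForm , ⇔.trans bigraphForm vertexCliqueForm , ⇔.trans bigraphForm edgeCliqueForm
  where
  B = bigraphOf ℋ
  -- (1) ⇔ (2): the counting characterisation plus crossing pairs = induced 2P₃
  bigraphForm : OneSperner ℋ ⇔ (RightSperner B × BigraphFree 2P₃ B)
  bigraphForm = ⇔.trans (oneSperner⇔ ℋ) (⇔.refl ×-⇔ ⇔.sym (2P₃-free⇔CrossingFree B))
  -- (2) ⇔ (3): the vertex-clique split graph is B, and H̄ is 2P₃ up to relabelling
  vertexCliqueForm : (RightSperner B × BigraphFree 2P₃ B) ⇔
    (IndependentSperner (vertexCliqueSplit ℋ) × SplitFree H̄s (vertexCliqueSplit ℋ))
  vertexCliqueForm = ⇔.refl ×-⇔ ⇔.sym (⇔.trans splitFree⇔ (free-pattern⇔ H̄↪2P₃ 2P₃↪H̄))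
  -- (2) ⇔ (4): the edge-clique split graph is the transpose of B, and H of 2P₃
  edgeCliqueForm : (RightSperner B × BigraphFree 2P₃ B) ⇔
    (CliqueSperner (edgeCliqueSplit ℋ) × SplitFree Hs (edgeCliqueSplit ℋ))
  edgeCliqueForm = ⇔.refl ×-⇔ ⇔.sym (⇔.trans splitFree⇔ (⇔.sym (free-transpose⇔ 2P₃ B)))
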